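{- Let $f=(f_1,\dots,f_n):\mathbb{N}_0\to\mathbb{Z}^n$, where each $f_i\in\mathbb{Q}[x]$ satisfies $f_i(\mathbb{N}_0)\subseteq\mathbb{Z}$. Assume that at least two of the $f_i$ have degree $\ge0$ (i.e. are nonzero) and that at least two of the $f_j$ are not proportional to each other. Then for every $m\in\mathbb{N}$, the set $\bigcup_{k=1}^m kf(\mathbb{N}_0)$, and hence each $kf(\mathbb{N}_0)$ with $1\le k\le m$, is a proper subset of $[f(\mathbb{N}_0)]$.
   Context: $\mathbb{N}$ (resp. $\mathbb{N}_0$) denotes the positive (resp. non-negative) integers. For a subset $A$ of an abelian group, $kA$ is the $k$-fold sumset $\{a_1+\cdots+a_k: a_i\in A\}$, and $[A]$ denotes the commutative semigroup generated by $A$ (all finite nonempty sums of elements of $A$). -}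

module Defs where

open import Data.Nat using (ℕ; zero; suc; _≤_)
open import Data.Fin using (Fin; zero; suc)
open import Data.Integer using (ℤ) renaming (_+_ to _+ℤ_; +_ to ℤ+_)
open import Data.Rational using (ℚ; 0ℚ; _+_; _*_; _/_)
open import Data.List using (List; []; _∷_)
open import Data.Product using (Σ; ∃; _×_; _,_)
open import Relation.Binary.PropositionalEquality using (_≡_; _≢_)
open import Relation.Nullary using (¬_)

-- A polynomial in ℚ[x], given by its list of coefficients [a₀, a₁, …, a_d]
-- (trailing zeros allowed; equality of polynomials is coefficientwise, via coeff).
Poly : Set
Poly = List ℚ

coeff : Poly → ℕ → ℚ
coeff []       _       = 0ℚ
coeff (a ∷ p)  zero    = a
coeff (a ∷ p)  (suc k) = coeff p k

eval : Poly → ℚ → ℚ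
eval []      x = 0ℚ
eval (a ∷ p) x = a + x * eval p x

ℤ→ℚ : ℤ → ℚ
ℤ→ℚ z = z / 1

ℕ→ℚ : ℕ → ℚ
ℕ→ℚ n = ℤ→ℚ (ℤ+ n)

NonZeroPoly : Poly → Set
NonZeroPoly p = ∃ λ k → coeff p k ≢ 0ℚ

Proportional : Poly → Poly → Set
Proportional p q =
  Σ ℚ λ a → Σ ℚ λ b → ¬ (a ≡ 0ℚ × b ≡ 0ℚ) × (∀ k → a * coeff p k + b * coeff q k ≡ 0ℚ)

ℤVec : ℕ → Set
ℤVec n = Fin n → ℤ

_≋_ : ∀ {n} → ℤVec n → ℤVec n → Set
u ≋ v = ∀ i → u i ≡ v i

zeroV : ∀ {n} → ℤVec n
zeroV i = ℤ+ 0

_⊕_ : ∀ {n} → ℤVec n → ℤVec n → ℤVec n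
(u ⊕ v) i = u i +ℤ v i

sumImg : ∀ {n} (f : ℕ → ℤVec n) (k : ℕ) → (Fin k → ℕ) → ℤVec n
sumImg f zero    xs = zeroV
sumImg f (suc k) xs = f (xs zero) ⊕ sumImg f k (λ j → xs (suc j))

-- v ∈ k·f(ℕ₀)  (k-fold sumset)
InSumset : ∀ {n} (f : ℕ → ℤVec n) (k : ℕ) → ℤVec n → Set
InSumset f k v = Σ (Fin k → ℕ) λ xs → sumImg f k xs ≋ v

-- v ∈ [f(ℕ₀)]  (semigroup generated: finite nonempty sums)
InSemigroup : ∀ {n} (f : ℕ → ℤVec n) → ℤVec n → Set
InSemigroup f v = Σ ℕ λ k → 1 ≤ k × InSumset f k v

-- Let g, h be non-proportional components of f, let D be the largest index where g or h has a nonzero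
-- coefficient, and let c, d be those coefficients. Then ψ = d·g − c·h is a nonzero polynomial of degree
-- < D, while φ = c·g + d·h has degree D and leading coefficient c² + d² > 0; hence for every M there is
-- K with M·|ψ(x)| ≤ φ(x) + K on ℕ₀. Pick a with ψ(a) ≠ 0 and M with M·|ψ(a)| > |φ(a)| + 1. If
-- N·f(a) = f(x₁) + ⋯ + f(x_k) with k ≤ m, applying the linear maps ψ, φ and summing the bounds gives
-- N·(|φ(a)| + 1) ≤ N·|φ(a)| + m·K, which fails once N > m·K. So N·f(a) ∈ [f(ℕ₀)] lies in no k·f(ℕ₀), k ≤ m.
module Submission where

open import Defs
open import Algebra.Bundles using (Ring)
open import Data.Empty using (⊥-elim)
open import Data.Fin as Fin using (Fin)
open import Data.Integer as ℤ using (-[1+_])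
import Data.Integer.Properties as ℤₚ
open import Data.List using ([]; _∷_; length; map)
open import Data.Nat as ℕ using (ℕ; zero; suc; z≤n; s≤s)
import Data.Nat.Properties as ℕₚ
open import Data.Product using (Σ; ∃; _×_; _,_; proj₁; proj₂)
open import Data.Rational as ℚ
  using (ℚ; mkℚ; toℚᵘ; positive; nonNegative; >-nonZero; 0ℚ; 1ℚ; _+_; _*_; _-_; -_; ∣_∣; _⊔_; _≤_; _<_; 1/_)
open import Data.Rational.Properties
open import Algebra.Definitions.RawSemiring ℚ.+-*-rawSemiring using (_^_)
open import Algebra.Properties.Semiring.Sum (Ring.semiring +-*-ring)
  using (sum; sum-cong-≗; ∑-distrib-+; *-distribˡ-sum)
open import Data.Rational.Solver using (module +-*-Solver)
open +-*-Solver
import Data.Rational.Unnormalised as ℚᵘ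
import Data.Rational.Unnormalised.Properties as ℚᵘₚ
open import Data.Sum using (_⊎_; inj₁; inj₂)
open import Data.Vec.Functional using (Vector)
open import Function using (_∘_)
open import Relation.Binary.PropositionalEquality
open import Relation.Nullary using (¬_; yes; no)
open import Relation.Nullary.Decidable using (_×-dec_)
open import Relation.Unary using (Decidable)

ℤ→ℚ-homo-+ : ∀ a b → ℤ→ℚ (a ℤ.+ b) ≡ ℤ→ℚ a + ℤ→ℚ b
ℤ→ℚ-homo-+ a b = toℚᵘ-injective (begin
  toℚᵘ (ℤ→ℚ (a ℤ.+ b))            ≈⟨ toℚᵘ-fromℚᵘ (ℚᵘ.mkℚᵘ (a ℤ.+ b) 0) ⟩
  ℚᵘ.mkℚᵘ (a ℤ.+ b) 0              ≈⟨ ℚᵘ.*≡* (cong₂ (λ u v → (u ℤ.+ v) ℤ.* ℤ.+ 1)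
                                        (sym (ℤₚ.*-identityʳ a)) (sym (ℤₚ.*-identityʳ b))) ⟩
  ℚᵘ.mkℚᵘ a 0 ℚᵘ.+ ℚᵘ.mkℚᵘ b 0    ≈⟨ ℚᵘₚ.+-cong (toℚᵘ-fromℚᵘ (ℚᵘ.mkℚᵘ a 0)) (toℚᵘ-fromℚᵘ (ℚᵘ.mkℚᵘ b 0)) ⟨
  toℚᵘ (ℤ→ℚ a) ℚᵘ.+ toℚᵘ (ℤ→ℚ b)  ≈⟨ toℚᵘ-homo-+ (ℤ→ℚ a) (ℤ→ℚ b) ⟨
  toℚᵘ (ℤ→ℚ a + ℤ→ℚ b)            ∎)
  where open ℚᵘₚ.≃-Reasoning

ℕ→ℚ-suc : ∀ n → ℕ→ℚ (suc n) ≡ 1ℚ + ℕ→ℚ n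
ℕ→ℚ-suc n = ℤ→ℚ-homo-+ (ℤ.+ 1) (ℤ.+ n)

ℤ→ℚ-mono-≤ : ∀ {a b} → a ℤ.≤ b → ℤ→ℚ a ≤ ℤ→ℚ b
ℤ→ℚ-mono-≤ {a} {b} a≤b = toℚᵘ-cancel-≤
  (ℚᵘₚ.≤-respˡ-≃ (ℚᵘₚ.≃-sym (toℚᵘ-fromℚᵘ (ℚᵘ.mkℚᵘ a 0)))
  (ℚᵘₚ.≤-respʳ-≃ (ℚᵘₚ.≃-sym (toℚᵘ-fromℚᵘ (ℚᵘ.mkℚᵘ b 0)))
  (ℚᵘ.*≤* (subst₂ ℤ._≤_ (sym (ℤₚ.*-identityʳ a)) (sym (ℤₚ.*-identityʳ b)) a≤b))))

ℕ→ℚ-mono-≤ : ∀ {m n} → m ℕ.≤ n → ℕ→ℚ m ≤ ℕ→ℚ n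
ℕ→ℚ-mono-≤ {m} {n} m≤n = ℤ→ℚ-mono-≤ {ℤ.+ m} {ℤ.+ n} (ℤ.+≤+ m≤n)

ℕ→ℚ-nonNeg : ∀ n → 0ℚ ≤ ℕ→ℚ n
ℕ→ℚ-nonNeg n = ℕ→ℚ-mono-≤ {0} {n} z≤n

-- A numerator bounds its fraction: num / (1 + d) < 1 + ∣ num ∣.
archimedean-ℕ : ∀ p → ∃ λ n → p < ℕ→ℚ n
archimedean-ℕ (mkℚ num d _) = suc ℤ.∣ num ∣ , toℚᵘ-cancel-<
  (ℚᵘₚ.<-respʳ-≃ (ℚᵘₚ.≃-sym (toℚᵘ-fromℚᵘ (ℚᵘ.mkℚᵘ (ℤ.+ suc ℤ.∣ num ∣) 0)))
    (ℚᵘ.*<* (num<∣num∣ num)))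
  where
  num<∣num∣ : ∀ num → num ℤ.* ℤ.+ 1 ℤ.< ℤ.+ suc ℤ.∣ num ∣ ℤ.* ℤ.+ suc d
  num<∣num∣ (ℤ.+ n) rewrite ℤₚ.*-identityʳ (ℤ.+ n) =
    ℤ.+<+ (s≤s (ℕₚ.≤-trans (ℕₚ.m≤m*n n (suc d)) (ℕₚ.m≤n+m (n ℕ.* suc d) d)))
  num<∣num∣ -[1+ n ] = ℤ.-<+

archimedean : ∀ p q → 0ℚ < q → ∃ λ N → ∀ n → N ℕ.≤ n → p < q * ℕ→ℚ n
archimedean p q 0<q = N , λ n N≤n → begin-strict
  p                ≡⟨ p≡q*[p/q] ⟩
  q * (p * 1/ q)   <⟨ *-monoʳ-<-pos q p/q<N ⟩
  q * ℕ→ℚ N        ≤⟨ *-monoˡ-≤-nonNeg q (ℕ→ℚ-mono-≤ N≤n) ⟩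
  q * ℕ→ℚ n        ∎
  where
  open ≤-Reasoning
  instance
    _ = positive 0<q
    _ = >-nonZero 0<q
    _ = pos⇒nonNeg q
  N = proj₁ (archimedean-ℕ (p * 1/ q))
  p/q<N = proj₂ (archimedean-ℕ (p * 1/ q))
  p≡q*[p/q] : p ≡ q * (p * 1/ q)
  p≡q*[p/q] = sym (begin-equality
    q * (p * 1/ q)  ≡⟨ solve 3 (λ q p r → q :* (p :* r) := p :* (q :* r)) refl q p (1/ q) ⟩
    p * (q * 1/ q)  ≡⟨ cong (p *_) (*-inverseʳ q) ⟩
    p * 1ℚ          ≡⟨ *-identityʳ p ⟩
    p               ∎)

*-monoˡ-≤-0≤ : ∀ {r p q} → 0ℚ ≤ r → p ≤ q → r * p ≤ r * q
*-monoˡ-≤-0≤ {r} 0≤r = *-monoˡ-≤-nonNeg r {{nonNegative 0≤r}}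

*-monoʳ-≤-0≤ : ∀ {r p q} → 0ℚ ≤ r → p ≤ q → p * r ≤ q * r
*-monoʳ-≤-0≤ {r} 0≤r = *-monoʳ-≤-nonNeg r {{nonNegative 0≤r}}

p≤∣p∣ : ∀ p → p ≤ ∣ p ∣
p≤∣p∣ (mkℚ (ℤ.+ _)  _ _) = ≤-refl
p≤∣p∣ (mkℚ -[1+ _ ] _ _) = ℚ.*≤* ℤ.-≤+

∣p*q∣≡p*∣q∣ : ∀ {p} q → 0ℚ ≤ p → ∣ p * q ∣ ≡ p * ∣ q ∣
∣p*q∣≡p*∣q∣ {p} q 0≤p = trans (∣p*q∣≡∣p∣*∣q∣ p q) (cong (_* ∣ q ∣) (0≤p⇒∣p∣≡p 0≤p))

∣p*q∣≡∣p∣*q : ∀ p {q} → 0ℚ ≤ q → ∣ p * q ∣ ≡ ∣ p ∣ * q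
∣p*q∣≡∣p∣*q p {q} 0≤q = trans (∣p*q∣≡∣p∣*∣q∣ p q) (cong (∣ p ∣ *_) (0≤p⇒∣p∣≡p 0≤q))

Degree≤ : Poly → ℕ → Set
Degree≤ p D = ∀ k → D ℕ.< k → coeff p k ≡ 0ℚ

coeff-≥length : ∀ p k → length p ℕ.≤ k → coeff p k ≡ 0ℚ
coeff-≥length []      k       _           = refl
coeff-≥length (a ∷ p) (suc k) (s≤s len≤k) = coeff-≥length p k len≤k

eval-zeroPoly : ∀ p → (∀ k → coeff p k ≡ 0ℚ) → ∀ y → eval p y ≡ 0ℚ
eval-zeroPoly []      _     y = refl
eval-zeroPoly (a ∷ p) coeff≡0 y = begin
  a + y * eval p y  ≡⟨ cong₂ (λ b e → b + y * e) (coeff≡0 0) (eval-zeroPoly p (coeff≡0 ∘ suc) y) ⟩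
  0ℚ + y * 0ℚ       ≡⟨ solve 1 (λ y → con 0ℚ :+ y :* con 0ℚ := con 0ℚ) refl y ⟩
  0ℚ                ∎
  where open ≡-Reasoning

1≤⇒0< : ∀ {y} → 1ℚ ≤ y → 0ℚ < y
1≤⇒0< = <-≤-trans (positive⁻¹ 1ℚ)

1≤⇒0≤ : ∀ {y} → 1ℚ ≤ y → 0ℚ ≤ y
1≤⇒0≤ = <⇒≤ ∘ 1≤⇒0<

1≤^ : ∀ {y} D → 1ℚ ≤ y → 1ℚ ≤ y ^ D
1≤^ zero    1≤y = ≤-refl
1≤^ {y} (suc D) 1≤y = begin
  1ℚ         ≤⟨ 1≤^ D 1≤y ⟩
  y ^ D      ≡⟨ *-identityˡ (y ^ D) ⟨
  1ℚ * y ^ D ≤⟨ *-monoʳ-≤-0≤ (1≤⇒0≤ (1≤^ D 1≤y)) 1≤y ⟩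
  y * y ^ D  ∎
  where open ≤-Reasoning

leading-term-approx : ∀ p D → Degree≤ p D →
  ∃ λ S → ∀ y → 1ℚ ≤ y → ∣ eval p y - coeff p D * y ^ D ∣ * y ≤ S * y ^ D
leading-term-approx [] D _ = 0ℚ , λ y _ → ≤-reflexive (begin
  ∣ 0ℚ - 0ℚ * y ^ D ∣ * y  ≡⟨ cong (λ t → ∣ 0ℚ - t ∣ * y) (*-zeroˡ (y ^ D)) ⟩
  0ℚ * y                   ≡⟨ *-zeroˡ y ⟩
  0ℚ                       ≡⟨ *-zeroˡ (y ^ D) ⟨
  0ℚ * y ^ D               ∎)
  where open ≡-Reasoning
leading-term-approx (a ∷ p) zero deg≤0 = 0ℚ , λ y _ → ≤-reflexive (begin
  ∣ a + y * eval p y - a * 1ℚ ∣ * y  ≡⟨ cong (λ e → ∣ a + y * e - a * 1ℚ ∣ * y) (p≡0 y) ⟩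
  ∣ a + y * 0ℚ - a * 1ℚ ∣ * y        ≡⟨ cong (λ t → ∣ t ∣ * y)
                                         (solve 2 (λ a y → a :+ y :* con 0ℚ :- a :* con 1ℚ := con 0ℚ) refl a y) ⟩
  0ℚ * y                             ≡⟨ *-zeroˡ y ⟩
  0ℚ                                 ≡⟨ *-zeroˡ 1ℚ ⟨
  0ℚ * 1ℚ                            ∎)
  where
  open ≡-Reasoning
  p≡0 : ∀ y → eval p y ≡ 0ℚ
  p≡0 = eval-zeroPoly p (λ k → deg≤0 (suc k) (s≤s z≤n))
leading-term-approx (a ∷ p) (suc D) deg≤1+D = ∣ a ∣ + S , bound
  where
  S = proj₁ (leading-term-approx p D (λ k D<k → deg≤1+D (suc k) (s≤s D<k)))
  approx = proj₂ (leading-term-approx p D (λ k D<k → deg≤1+D (suc k) (s≤s D<k)))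
  bound : ∀ y → 1ℚ ≤ y → ∣ a + y * eval p y - coeff p D * (y * y ^ D) ∣ * y ≤ (∣ a ∣ + S) * (y * y ^ D)
  bound y 1≤y = begin
    ∣ a + y * eval p y - c * (y * yᴰ) ∣ * y  ≡⟨ cong (λ t → ∣ t ∣ * y)
      (solve 5 (λ a y e c z → a :+ y :* e :- c :* (y :* z) := a :+ y :* (e :- c :* z))
        refl a y (eval p y) c yᴰ) ⟩
    ∣ a + y * err ∣ * y                      ≤⟨ *-monoʳ-≤-0≤ 0≤y (∣p+q∣≤∣p∣+∣q∣ a (y * err)) ⟩
    (∣ a ∣ + ∣ y * err ∣) * y                ≡⟨ cong (λ t → (∣ a ∣ + t) * y) (∣p*q∣≡p*∣q∣ err 0≤y) ⟩
    (∣ a ∣ + y * ∣ err ∣) * y                ≡⟨ solve 3 (λ a y e → (a :+ y :* e) :* y := a :* y :+ y :* (e :* y))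
                                                  refl (∣ a ∣) y (∣ err ∣) ⟩
    ∣ a ∣ * y + y * (∣ err ∣ * y)            ≤⟨ +-mono-≤ (*-monoˡ-≤-0≤ (0≤∣p∣ a) y≤y*yᴰ)
                                                          (*-monoˡ-≤-0≤ 0≤y (approx y 1≤y)) ⟩
    ∣ a ∣ * (y * yᴰ) + y * (S * yᴰ)          ≡⟨ solve 4 (λ a S y z → a :* (y :* z) :+ y :* (S :* z) := (a :+ S) :* (y :* z))
                                                  refl (∣ a ∣) S y yᴰ ⟩
    (∣ a ∣ + S) * (y * yᴰ)                   ∎
    where
    open ≤-Reasoning
    c = coeff p D
    yᴰ = y ^ D
    err = eval p y - c * yᴰ
    0≤y = 1≤⇒0≤ 1≤y
    y≤y*yᴰ : y ≤ y * yᴰ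
    y≤y*yᴰ = subst (_≤ y * yᴰ) (*-identityʳ y) (*-monoˡ-≤-0≤ 0≤y (1≤^ D 1≤y))

all⊎lastCounterexample : ∀ {P : ℕ → Set} → Decidable P → ∀ L → (∀ k → L ℕ.≤ k → P k) →
  (∀ k → P k) ⊎ ∃ λ D → ¬ P D × ∀ k → D ℕ.< k → P k
all⊎lastCounterexample P? zero    P≥0 = inj₁ (λ k → P≥0 k z≤n)
all⊎lastCounterexample {P} P? (suc L) P>L with P? L
... | no ¬PL = inj₂ (L , ¬PL , P>L)
... | yes PL = all⊎lastCounterexample P? L P≥L
  where
  P≥L : ∀ k → L ℕ.≤ k → P k
  P≥L k L≤k with ℕₚ.m≤n⇒m<n∨m≡n L≤k
  ... | inj₁ L<k  = P>L k L<k
  ... | inj₂ refl = PL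

p≢0⇒0<∣p∣ : ∀ {p} → p ≢ 0ℚ → 0ℚ < ∣ p ∣
p≢0⇒0<∣p∣ {p} p≢0 = ≰⇒> (λ ∣p∣≤0 → p≢0 (∣p∣≡0⇒p≡0 p (≤-antisym ∣p∣≤0 (0≤∣p∣ p))))

-- For large y the leading term e·yᴱ outweighs the rest, so p(y) ≠ 0.
nonzeroPoly-nonroot : ∀ p → ¬ (∀ k → coeff p k ≡ 0ℚ) → ∃ λ x → eval p (ℕ→ℚ x) ≢ 0ℚ
nonzeroPoly-nonroot p p≢0
  with all⊎lastCounterexample (λ k → coeff p k ≟ 0ℚ) (length p) (coeff-≥length p)
... | inj₁ p≡0 = ⊥-elim (p≢0 p≡0)
... | inj₂ (E , e≢0 , deg≤E) = suc N , root-free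
  where
  e = coeff p E
  S = proj₁ (leading-term-approx p E deg≤E)
  approx = proj₂ (leading-term-approx p E deg≤E)
  N = proj₁ (archimedean S ∣ e ∣ (p≢0⇒0<∣p∣ e≢0))
  S<∣e∣x = proj₂ (archimedean S ∣ e ∣ (p≢0⇒0<∣p∣ e≢0))
  y = ℕ→ℚ (suc N)
  1≤y : 1ℚ ≤ y
  1≤y = ℕ→ℚ-mono-≤ {1} {suc N} (s≤s z≤n)
  root-free : eval p y ≢ 0ℚ
  root-free py≡0 = <-irrefl refl (<-≤-trans (S<∣e∣x (suc N) (ℕₚ.n≤1+n N)) ∣e∣y≤S)
    where
    yᴱ = y ^ E
    instance _ = positive (1≤⇒0< (1≤^ E 1≤y))
    ∣e∣y≤S : ∣ e ∣ * y ≤ S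
    ∣e∣y≤S = *-cancelʳ-≤-pos yᴱ (begin
      ∣ e ∣ * y * yᴱ              ≡⟨ solve 3 (λ e y z → e :* y :* z := e :* z :* y) refl (∣ e ∣) y yᴱ ⟩
      ∣ e ∣ * yᴱ * y              ≡⟨ cong (_* y) (∣p*q∣≡∣p∣*q e (1≤⇒0≤ (1≤^ E 1≤y))) ⟨
      ∣ e * yᴱ ∣ * y              ≡⟨ cong (_* y) (∣-p∣≡∣p∣ (e * yᴱ)) ⟨
      ∣ - (e * yᴱ) ∣ * y          ≡⟨ cong (λ t → ∣ t ∣ * y) (+-identityˡ (- (e * yᴱ))) ⟨
      ∣ 0ℚ - e * yᴱ ∣ * y         ≡⟨ cong (λ t → ∣ t - e * yᴱ ∣ * y) py≡0 ⟨
      ∣ eval p y - e * yᴱ ∣ * y   ≤⟨ approx y 1≤y ⟩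
      S * yᴱ                      ∎)
      where open ≤-Reasoning

infixl 6 _⊞_
_⊞_ : Poly → Poly → Poly
[]      ⊞ q       = q
(a ∷ p) ⊞ []      = a ∷ p
(a ∷ p) ⊞ (b ∷ q) = (a + b) ∷ (p ⊞ q)

infixr 7 _⊛_
_⊛_ : ℚ → Poly → Poly
u ⊛ p = map (u *_) p

coeff-⊞ : ∀ p q k → coeff (p ⊞ q) k ≡ coeff p k + coeff q k
coeff-⊞ []      q       k       = sym (+-identityˡ (coeff q k))
coeff-⊞ (a ∷ p) []      k       = sym (+-identityʳ (coeff (a ∷ p) k))
coeff-⊞ (a ∷ p) (b ∷ q) zero    = refl
coeff-⊞ (a ∷ p) (b ∷ q) (suc k) = coeff-⊞ p q k

coeff-⊛ : ∀ u p k → coeff (u ⊛ p) k ≡ u * coeff p k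
coeff-⊛ u []      k       = sym (*-zeroʳ u)
coeff-⊛ u (a ∷ p) zero    = refl
coeff-⊛ u (a ∷ p) (suc k) = coeff-⊛ u p k

eval-⊞ : ∀ p q y → eval (p ⊞ q) y ≡ eval p y + eval q y
eval-⊞ []      q       y = sym (+-identityˡ (eval q y))
eval-⊞ (a ∷ p) []      y = sym (+-identityʳ (eval (a ∷ p) y))
eval-⊞ (a ∷ p) (b ∷ q) y = begin
  a + b + y * eval (p ⊞ q) y             ≡⟨ cong (λ t → a + b + y * t) (eval-⊞ p q y) ⟩
  a + b + y * (eval p y + eval q y)      ≡⟨ solve 5 (λ a b y e f → a :+ b :+ y :* (e :+ f) := a :+ y :* e :+ (b :+ y :* f))
                                              refl a b y (eval p y) (eval q y) ⟩
  a + y * eval p y + (b + y * eval q y)  ∎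
  where open ≡-Reasoning

eval-⊛ : ∀ u p y → eval (u ⊛ p) y ≡ u * eval p y
eval-⊛ u []      y = sym (*-zeroʳ u)
eval-⊛ u (a ∷ p) y = begin
  u * a + y * eval (u ⊛ p) y  ≡⟨ cong (λ t → u * a + y * t) (eval-⊛ u p y) ⟩
  u * a + y * (u * eval p y)  ≡⟨ solve 4 (λ u a y e → u :* a :+ y :* (u :* e) := u :* (a :+ y :* e)) refl u a y (eval p y) ⟩
  u * (a + y * eval p y)      ∎
  where open ≡-Reasoning

coeff-⊛⊞⊛ : ∀ u v p q k → coeff (u ⊛ p ⊞ v ⊛ q) k ≡ u * coeff p k + v * coeff q k
coeff-⊛⊞⊛ u v p q k = trans (coeff-⊞ (u ⊛ p) (v ⊛ q) k) (cong₂ _+_ (coeff-⊛ u p k) (coeff-⊛ v q k))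

eval-⊛⊞⊛ : ∀ u v p q y → eval (u ⊛ p ⊞ v ⊛ q) y ≡ u * eval p y + v * eval q y
eval-⊛⊞⊛ u v p q y = trans (eval-⊞ (u ⊛ p) (v ⊛ q) y) (cong₂ _+_ (eval-⊛ u p y) (eval-⊛ v q y))

infix 4 _≺_
_≺_ : Poly → Poly → Set
p ≺ q = ∃ λ D → Degree≤ p D × coeff p D ≡ 0ℚ × Degree≤ q D × 0ℚ < coeff q D

p-q≤r⇒p≤q+r : ∀ {p q r} → p - q ≤ r → p ≤ q + r
p-q≤r⇒p≤q+r {p} {q} {r} p-q≤r = begin
  p            ≡⟨ solve 2 (λ p q → p := q :+ (p :- q)) refl p q ⟩
  q + (p - q)  ≤⟨ +-monoʳ-≤ q p-q≤r ⟩
  q + r        ∎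
  where open ≤-Reasoning

∣a-b∣*y≤s⇒b*y-s≤a*y : ∀ {a b y s} → 0ℚ ≤ y → ∣ a - b ∣ * y ≤ s → b * y - s ≤ a * y
∣a-b∣*y≤s⇒b*y-s≤a*y {a} {b} {y} {s} 0≤y ∣a-b∣y≤s = begin
  b * y - s            ≤⟨ +-monoʳ-≤ (b * y) (neg-antimono-≤ [b-a]y≤s) ⟩
  b * y - (b - a) * y  ≡⟨ solve 3 (λ a b y → b :* y :- (b :- a) :* y := a :* y) refl a b y ⟩
  a * y                ∎
  where
  open ≤-Reasoning
  [b-a]y≤s : (b - a) * y ≤ s
  [b-a]y≤s = begin
    (b - a) * y        ≤⟨ *-monoʳ-≤-0≤ 0≤y (p≤∣p∣ (b - a)) ⟩
    ∣ b - a ∣ * y      ≡⟨ cong (λ t → ∣ t ∣ * y) (solve 2 (λ a b → b :- a := :- (a :- b)) refl a b) ⟩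
    ∣ - (a - b) ∣ * y  ≡⟨ cong (_* y) (∣-p∣≡∣p∣ (a - b)) ⟩
    ∣ a - b ∣ * y      ≤⟨ ∣a-b∣y≤s ⟩
    s                  ∎

≺⇒eventually-dominated : ∀ p q → p ≺ q → ∀ {M} → 0ℚ ≤ M →
  ∃ λ X → ∀ x → X ℕ.≤ x → M * ∣ eval p (ℕ→ℚ x) ∣ ≤ eval q (ℕ→ℚ x)
≺⇒eventually-dominated p q (D , deg-p , p_D≡0 , deg-q , 0<e) {M} 0≤M = suc X , dominated
  where
  e = coeff q D
  Sp = proj₁ (leading-term-approx p D deg-p)
  Sq = proj₁ (leading-term-approx q D deg-q)
  X = proj₁ (archimedean (M * Sp + Sq) e 0<e)
  dominated : ∀ x → suc X ℕ.≤ x → M * ∣ eval p (ℕ→ℚ x) ∣ ≤ eval q (ℕ→ℚ x)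
  dominated x X<x = *-cancelʳ-≤-pos y (begin
    M * ∣ eval p y ∣ * y             ≡⟨ *-assoc M (∣ eval p y ∣) y ⟩
    M * (∣ eval p y ∣ * y)           ≤⟨ *-monoˡ-≤-0≤ 0≤M p-bound ⟩
    M * (Sp * yᴰ)                    ≡⟨ solve 4 (λ M S T z → M :* (S :* z) := (M :* S :+ T) :* z :- T :* z)
                                          refl M Sp Sq yᴰ ⟩
    (M * Sp + Sq) * yᴰ - Sq * yᴰ     ≤⟨ +-monoˡ-≤ (- (Sq * yᴰ)) (*-monoʳ-≤-0≤ (1≤⇒0≤ 1≤yᴰ) (<⇒≤ MSp+Sq<ey)) ⟩
    e * y * yᴰ - Sq * yᴰ             ≡⟨ cong (_- Sq * yᴰ) (solve 3 (λ e y z → e :* y :* z := e :* z :* y) refl e y yᴰ) ⟩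
    e * yᴰ * y - Sq * yᴰ             ≤⟨ ∣a-b∣*y≤s⇒b*y-s≤a*y {eval q y} {e * yᴰ} (1≤⇒0≤ 1≤y)
                                          (proj₂ (leading-term-approx q D deg-q) y 1≤y) ⟩
    eval q y * y                     ∎)
    where
    open ≤-Reasoning
    y = ℕ→ℚ x
    yᴰ = y ^ D
    1≤y : 1ℚ ≤ y
    1≤y = ℕ→ℚ-mono-≤ {1} {x} (ℕₚ.≤-trans (s≤s z≤n) X<x)
    1≤yᴰ = 1≤^ D 1≤y
    instance _ = positive (1≤⇒0< 1≤y)
    MSp+Sq<ey : M * Sp + Sq < e * y
    MSp+Sq<ey = proj₂ (archimedean (M * Sp + Sq) e 0<e) x (ℕₚ.<⇒≤ X<x)
    p-bound : ∣ eval p y ∣ * y ≤ Sp * yᴰ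
    p-bound = begin
      ∣ eval p y ∣ * y                       ≡⟨ cong (λ t → ∣ t ∣ * y)
                                                  (solve 2 (λ a z → a := a :- con 0ℚ :* z) refl (eval p y) yᴰ) ⟩
      ∣ eval p y - 0ℚ * yᴰ ∣ * y             ≡⟨ cong (λ c → ∣ eval p y - c * yᴰ ∣ * y) p_D≡0 ⟨
      ∣ eval p y - coeff p D * yᴰ ∣ * y      ≤⟨ proj₂ (leading-term-approx p D deg-p) y 1≤y ⟩
      Sp * yᴰ                                ∎

p≤p+q : ∀ p {q} → 0ℚ ≤ q → p ≤ p + q
p≤p+q p {q} 0≤q = subst (_≤ p + q) (+-identityʳ p) (+-monoʳ-≤ p 0≤q)

maxExcess : (F G : ℕ → ℚ) → ℕ → ℚ
maxExcess F G zero    = 0ℚ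
maxExcess F G (suc X) = (F X - G X) ⊔ maxExcess F G X

maxExcess-nonNeg : ∀ F G X → 0ℚ ≤ maxExcess F G X
maxExcess-nonNeg F G zero    = ≤-refl
maxExcess-nonNeg F G (suc X) = p≤q⇒p≤r⊔q (F X - G X) (maxExcess-nonNeg F G X)

excess≤maxExcess : ∀ F G {x X} → x ℕ.< X → F x - G x ≤ maxExcess F G X
excess≤maxExcess F G {x} {suc X} (s≤s x≤X) with ℕₚ.m≤n⇒m<n∨m≡n x≤X
... | inj₁ x<X  = p≤q⇒p≤r⊔q (F X - G X) (excess≤maxExcess F G x<X)
... | inj₂ refl = p≤p⊔q (F x - G x) (maxExcess F G x)

eventually-≤⇒≤-+const : ∀ (F G : ℕ → ℚ) X → (∀ x → X ℕ.≤ x → F x ≤ G x) →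
  ∃ λ K → 0ℚ ≤ K × ∀ x → F x ≤ G x + K
eventually-≤⇒≤-+const F G X F≤G = maxExcess F G X , maxExcess-nonNeg F G X , F≤G+K
  where
  F≤G+K : ∀ x → F x ≤ G x + maxExcess F G X
  F≤G+K x with x ℕ.<? X
  ... | yes x<X = p-q≤r⇒p≤q+r (excess≤maxExcess F G x<X)
  ... | no  x≮X = ≤-trans (F≤G x (ℕₚ.≮⇒≥ x≮X)) (p≤p+q (G x) (maxExcess-nonNeg F G X))

≺⇒dominated : ∀ p q → p ≺ q → ∀ {M} → 0ℚ ≤ M →
  ∃ λ K → 0ℚ ≤ K × ∀ x → M * ∣ eval p (ℕ→ℚ x) ∣ ≤ eval q (ℕ→ℚ x) + K
≺⇒dominated p q p≺q {M} 0≤M =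
  eventually-≤⇒≤-+const (λ x → M * ∣ eval p (ℕ→ℚ x) ∣) (λ x → eval q (ℕ→ℚ x)) _
    (proj₂ (≺⇒eventually-dominated p q p≺q 0≤M))

p*p≡∣p∣*∣p∣ : ∀ p → p * p ≡ ∣ p ∣ * ∣ p ∣
p*p≡∣p∣*∣p∣ p with ∣p∣≡p∨∣p∣≡-p p
... | inj₁ ∣p∣≡p  = cong₂ _*_ (sym ∣p∣≡p) (sym ∣p∣≡p)
... | inj₂ ∣p∣≡-p = trans (solve 1 (λ p → p :* p := (:- p) :* (:- p)) refl p)
                          (cong₂ _*_ (sym ∣p∣≡-p) (sym ∣p∣≡-p))

0≤p*p : ∀ p → 0ℚ ≤ p * p
0≤p*p p = subst (0ℚ ≤_) (sym (p*p≡∣p∣*∣p∣ p))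
  (subst (_≤ ∣ p ∣ * ∣ p ∣) (*-zeroʳ ∣ p ∣) (*-monoˡ-≤-0≤ (0≤∣p∣ p) (0≤∣p∣ p)))

p≢0⇒0<p*p : ∀ {p} → p ≢ 0ℚ → 0ℚ < p * p
p≢0⇒0<p*p {p} p≢0 = subst (0ℚ <_) (sym (p*p≡∣p∣*∣p∣ p))
  (subst (_< ∣ p ∣ * ∣ p ∣) (*-zeroʳ ∣ p ∣) (*-monoʳ-<-pos ∣ p ∣ {{positive 0<∣p∣}} 0<∣p∣))
  where 0<∣p∣ = p≢0⇒0<∣p∣ p≢0

0<p*p+q*q : ∀ {p q} → ¬ (p ≡ 0ℚ × q ≡ 0ℚ) → 0ℚ < p * p + q * q
0<p*p+q*q {p} {q} ¬p≡0×q≡0 with p ≟ 0ℚ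
... | no  p≢0 = <-≤-trans (p≢0⇒0<p*p p≢0) (p≤p+q (p * p) (0≤p*p q))
... | yes p≡0 = <-≤-trans (p≢0⇒0<p*p (λ q≡0 → ¬p≡0×q≡0 (p≡0 , q≡0)))
                          (subst (q * q ≤_) (+-comm (q * q) (p * p)) (p≤p+q (q * q) (0≤p*p p)))

cross dot : ℕ → Poly → Poly → Poly
cross D g h = coeff h D ⊛ g ⊞ (- coeff g D) ⊛ h
dot   D g h = coeff g D ⊛ g ⊞ coeff h D ⊛ h

¬proportional⇒cross≺dot : ∀ g h → ¬ Proportional g h →
  ∃ λ D → ¬ (∀ k → coeff (cross D g h) k ≡ 0ℚ) × cross D g h ≺ dot D g h
¬proportional⇒cross≺dot g h ¬g∼h
  with all⊎lastCounterexample (λ k → (coeff g k ≟ 0ℚ) ×-dec (coeff h k ≟ 0ℚ)) (length g ℕ.+ length h)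
         (λ k len≤k → coeff-≥length g k (ℕₚ.m+n≤o⇒m≤o (length g) len≤k) ,
                      coeff-≥length h k (ℕₚ.m+n≤o⇒n≤o (length g) len≤k))
... | inj₁ g≡0×h≡0 = ⊥-elim (¬g∼h (1ℚ , 0ℚ , (λ ()) , λ k →
        cong₂ (λ a b → 1ℚ * a + 0ℚ * b) (proj₁ (g≡0×h≡0 k)) (proj₂ (g≡0×h≡0 k))))
... | inj₂ (D , ¬c≡0×d≡0 , top) = D , cross≢0 , (D , deg-cross , cross-D≡0 , deg-dot , 0<dot-D)
  where
  c = coeff g D
  d = coeff h D
  cross≢0 : ¬ (∀ k → coeff (cross D g h) k ≡ 0ℚ)
  cross≢0 cross≡0 = ¬g∼h (d , - c , (λ (d≡0 , -c≡0) → ¬c≡0×d≡0 (neg-injective -c≡0 , d≡0)) ,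
                         λ k → trans (sym (coeff-⊛⊞⊛ d (- c) g h k)) (cross≡0 k))
  deg-cross : Degree≤ (cross D g h) D
  deg-cross k D<k = begin
    coeff (cross D g h) k               ≡⟨ coeff-⊛⊞⊛ d (- c) g h k ⟩
    d * coeff g k + - c * coeff h k     ≡⟨ cong₂ (λ a b → d * a + - c * b) (proj₁ (top k D<k))
                                                                            (proj₂ (top k D<k)) ⟩
    d * 0ℚ + - c * 0ℚ                   ≡⟨ solve 2 (λ c d → d :* con 0ℚ :+ (:- c) :* con 0ℚ := con 0ℚ) refl c d ⟩
    0ℚ                                  ∎
    where open ≡-Reasoning
  cross-D≡0 : coeff (cross D g h) D ≡ 0ℚ
  cross-D≡0 = trans (coeff-⊛⊞⊛ d (- c) g h D) (solve 2 (λ c d → d :* c :+ (:- c) :* d := con 0ℚ) refl c d)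
  deg-dot : Degree≤ (dot D g h) D
  deg-dot k D<k = begin
    coeff (dot D g h) k             ≡⟨ coeff-⊛⊞⊛ c d g h k ⟩
    c * coeff g k + d * coeff h k   ≡⟨ cong₂ (λ a b → c * a + d * b) (proj₁ (top k D<k)) (proj₂ (top k D<k)) ⟩
    c * 0ℚ + d * 0ℚ                 ≡⟨ solve 2 (λ c d → c :* con 0ℚ :+ d :* con 0ℚ := con 0ℚ) refl c d ⟩
    0ℚ                              ∎
    where open ≡-Reasoning
  0<dot-D : 0ℚ < coeff (dot D g h) D
  0<dot-D = subst (0ℚ <_) (sym (coeff-⊛⊞⊛ c d g h D)) (0<p*p+q*q ¬c≡0×d≡0)

ℤ→ℚ-sumImg : ∀ {n} (f : ℕ → ℤVec n) k xs i → ℤ→ℚ (sumImg f k xs i) ≡ sum (λ t → ℤ→ℚ (f (xs t) i))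
ℤ→ℚ-sumImg f zero    xs i = refl
ℤ→ℚ-sumImg f (suc k) xs i = begin
  ℤ→ℚ (f₀ ℤ.+ sumImg f k (xs ∘ Fin.suc) i)         ≡⟨ ℤ→ℚ-homo-+ f₀ (sumImg f k (xs ∘ Fin.suc) i) ⟩
  ℤ→ℚ f₀ + ℤ→ℚ (sumImg f k (xs ∘ Fin.suc) i)       ≡⟨ cong (ℤ→ℚ f₀ +_) (ℤ→ℚ-sumImg f k (xs ∘ Fin.suc) i) ⟩
  ℤ→ℚ f₀ + sum (λ t → ℤ→ℚ (f (xs (Fin.suc t)) i))  ∎
  where
  open ≡-Reasoning
  f₀ = f (xs Fin.zero) i

sum-const : ∀ N q → sum {N} (λ _ → q) ≡ ℕ→ℚ N * q
sum-const zero    q = sym (*-zeroˡ q)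
sum-const (suc N) q = begin
  q + sum {N} (λ _ → q)  ≡⟨ cong (q +_) (sum-const N q) ⟩
  q + ℕ→ℚ N * q          ≡⟨ solve 2 (λ q n → q :+ n :* q := (con 1ℚ :+ n) :* q) refl q (ℕ→ℚ N) ⟩
  (1ℚ + ℕ→ℚ N) * q       ≡⟨ cong (_* q) (ℕ→ℚ-suc N) ⟨
  ℕ→ℚ (suc N) * q        ∎
  where open ≡-Reasoning

sum-linear : ∀ {k} u v (F G : Vector ℚ k) → sum (λ t → u * F t + v * G t) ≡ u * sum F + v * sum G
sum-linear u v F G = begin
  sum (λ t → u * F t + v * G t)                 ≡⟨ ∑-distrib-+ (λ t → u * F t) (λ t → v * G t) ⟩
  sum (λ t → u * F t) + sum (λ t → v * G t)     ≡⟨ cong₂ _+_ (*-distribˡ-sum u F) (*-distribˡ-sum v G) ⟨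
  u * sum F + v * sum G                         ∎
  where open ≡-Reasoning

sum-bound : ∀ {k M K} (u w : Vector ℚ k) → 0ℚ ≤ M → (∀ t → M * ∣ u t ∣ ≤ w t + K) →
  M * ∣ sum u ∣ ≤ sum w + ℕ→ℚ k * K
sum-bound {zero}  {M} {K} u w 0≤M _ = ≤-reflexive (begin-equality
  M * 0ℚ        ≡⟨ *-zeroʳ M ⟩
  0ℚ            ≡⟨ solve 1 (λ K → con 0ℚ := con 0ℚ :+ con 0ℚ :* K) refl K ⟩
  0ℚ + 0ℚ * K   ∎)
  where open ≤-Reasoning
sum-bound {suc k} {M} {K} u w 0≤M bound = begin
  M * ∣ u₀ + sum u' ∣                   ≤⟨ *-monoˡ-≤-0≤ 0≤M (∣p+q∣≤∣p∣+∣q∣ u₀ (sum u')) ⟩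
  M * (∣ u₀ ∣ + ∣ sum u' ∣)             ≡⟨ *-distribˡ-+ M (∣ u₀ ∣) (∣ sum u' ∣) ⟩
  M * ∣ u₀ ∣ + M * ∣ sum u' ∣           ≤⟨ +-mono-≤ (bound Fin.zero) (sum-bound u' w' 0≤M (bound ∘ Fin.suc)) ⟩
  w₀ + K + (sum w' + ℕ→ℚ k * K)         ≡⟨ solve 4 (λ a K s n → a :+ K :+ (s :+ n :* K) := a :+ s :+ (con 1ℚ :+ n) :* K)
                                             refl w₀ K (sum w') (ℕ→ℚ k) ⟩
  w₀ + sum w' + (1ℚ + ℕ→ℚ k) * K        ≡⟨ cong (λ n → w₀ + sum w' + n * K) (ℕ→ℚ-suc k) ⟨
  w₀ + sum w' + ℕ→ℚ (suc k) * K         ∎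
  where
  open ≤-Reasoning
  u₀ = u Fin.zero
  w₀ = w Fin.zero
  u' = u ∘ Fin.suc
  w' = w ∘ Fin.suc

+-cancelˡ-≤ : ∀ r {p q} → r + p ≤ r + q → p ≤ q
+-cancelˡ-≤ r {p} {q} r+p≤r+q = begin
  p             ≡⟨ solve 2 (λ r p → p := :- r :+ (r :+ p)) refl r p ⟩
  - r + (r + p) ≤⟨ +-monoʳ-≤ (- r) r+p≤r+q ⟩
  - r + (r + q) ≡⟨ solve 2 (λ r q → :- r :+ (r :+ q) := q) refl r q ⟩
  q             ∎
  where open ≤-Reasoning

multiple-not-short-sum : ∀ (ψ φ : ℕ → ℚ) a → ψ a ≢ 0ℚ →
  (∀ {M} → 0ℚ ≤ M → ∃ λ K → 0ℚ ≤ K × ∀ x → M * ∣ ψ x ∣ ≤ φ x + K) →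
  ∀ m → ∃ λ N → 1 ℕ.≤ N × ∀ {k} (xs : Fin k → ℕ) → k ℕ.≤ m →
    sum (ψ ∘ xs) ≡ ℕ→ℚ N * ψ a → sum (φ ∘ xs) ≢ ℕ→ℚ N * φ a
multiple-not-short-sum ψ φ a ψa≢0 dominated m = suc N₀ , s≤s z≤n , no-representation
  where
  A = φ a
  B = ψ a
  M₀ = proj₁ (archimedean (∣ A ∣ + 1ℚ) ∣ B ∣ (p≢0⇒0<∣p∣ ψa≢0))
  M = ℕ→ℚ M₀
  ∣A∣+1<∣B∣M : ∣ A ∣ + 1ℚ < ∣ B ∣ * M
  ∣A∣+1<∣B∣M = proj₂ (archimedean (∣ A ∣ + 1ℚ) ∣ B ∣ (p≢0⇒0<∣p∣ ψa≢0)) M₀ ℕₚ.≤-refl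
  0≤M = ℕ→ℚ-nonNeg M₀
  K = proj₁ (dominated 0≤M)
  0≤K = proj₁ (proj₂ (dominated 0≤M))
  M∣ψ∣≤φ+K = proj₂ (proj₂ (dominated 0≤M))
  N₀ = proj₁ (archimedean (ℕ→ℚ m * K) 1ℚ (positive⁻¹ 1ℚ))
  N = ℕ→ℚ (suc N₀)
  0≤N = ℕ→ℚ-nonNeg (suc N₀)
  mK<N : ℕ→ℚ m * K < N
  mK<N = subst (ℕ→ℚ m * K <_) (*-identityˡ N)
    (proj₂ (archimedean (ℕ→ℚ m * K) 1ℚ (positive⁻¹ 1ℚ)) (suc N₀) (ℕₚ.n≤1+n N₀))
  no-representation : ∀ {k} (xs : Fin k → ℕ) → k ℕ.≤ m →
    sum (ψ ∘ xs) ≡ N * B → sum (φ ∘ xs) ≢ N * A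
  no-representation {k} xs k≤m Σψ≡NB Σφ≡NA =
    <-irrefl refl (<-≤-trans mK<N (+-cancelˡ-≤ (N * ∣ A ∣) (begin
      N * ∣ A ∣ + N              ≡⟨ solve 2 (λ N A → N :* A :+ N := N :* (A :+ con 1ℚ)) refl N (∣ A ∣) ⟩
      N * (∣ A ∣ + 1ℚ)           ≤⟨ *-monoˡ-≤-0≤ 0≤N (<⇒≤ ∣A∣+1<∣B∣M) ⟩
      N * (∣ B ∣ * M)            ≡⟨ solve 3 (λ N B M → N :* (B :* M) := M :* (N :* B)) refl N (∣ B ∣) M ⟩
      M * (N * ∣ B ∣)            ≡⟨ cong (M *_) (∣p*q∣≡p*∣q∣ B 0≤N) ⟨
      M * ∣ N * B ∣              ≡⟨ cong (λ s → M * ∣ s ∣) Σψ≡NB ⟨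
      M * ∣ sum (ψ ∘ xs) ∣       ≤⟨ sum-bound (ψ ∘ xs) (φ ∘ xs) 0≤M (M∣ψ∣≤φ+K ∘ xs) ⟩
      sum (φ ∘ xs) + ℕ→ℚ k * K   ≡⟨ cong (_+ ℕ→ℚ k * K) Σφ≡NA ⟩
      N * A + ℕ→ℚ k * K          ≤⟨ +-mono-≤ (*-monoˡ-≤-0≤ 0≤N (p≤∣p∣ A)) (*-monoʳ-≤-0≤ 0≤K (ℕ→ℚ-mono-≤ k≤m)) ⟩
      N * ∣ A ∣ + ℕ→ℚ m * K      ∎)))
    where open ≤-Reasoning

sum-eval-multiple-⊛⊞⊛ : ∀ {k} (ys : Vector ℚ k) y N u v p q →
  sum (λ t → eval p (ys t)) ≡ N * eval p y → sum (λ t → eval q (ys t)) ≡ N * eval q y →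
  sum (λ t → eval (u ⊛ p ⊞ v ⊛ q) (ys t)) ≡ N * eval (u ⊛ p ⊞ v ⊛ q) y
sum-eval-multiple-⊛⊞⊛ ys y N u v p q Σp≡Np Σq≡Nq = begin
  sum (λ t → eval (u ⊛ p ⊞ v ⊛ q) (ys t))            ≡⟨ sum-cong-≗ (λ t → eval-⊛⊞⊛ u v p q (ys t)) ⟩
  sum (λ t → u * eval p (ys t) + v * eval q (ys t))   ≡⟨ sum-linear u v (eval p ∘ ys) (eval q ∘ ys) ⟩
  u * sum (eval p ∘ ys) + v * sum (eval q ∘ ys)       ≡⟨ cong₂ (λ s s′ → u * s + v * s′) Σp≡Np Σq≡Nq ⟩
  u * (N * eval p y) + v * (N * eval q y)             ≡⟨ solve 5 (λ u v N e e′ → u :* (N :* e) :+ v :* (N :* e′)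
                                                                             := N :* (u :* e :+ v :* e′))
                                                           refl u v N (eval p y) (eval q y) ⟩
  N * (u * eval p y + v * eval q y)                   ≡⟨ cong (N *_) (eval-⊛⊞⊛ u v p q y) ⟨
  N * eval (u ⊛ p ⊞ v ⊛ q) y                          ∎
  where open ≡-Reasoning

module _ {n} (P : Fin n → Poly) (f : ℕ → ℤVec n) (P≗f : ∀ x i → eval (P i) (ℕ→ℚ x) ≡ ℤ→ℚ (f x i)) where

  sumImg≋multiple⇒sum-eval : ∀ {k} (xs : Fin k → ℕ) N a → sumImg f k xs ≋ sumImg f N (λ _ → a) →
    ∀ i → sum (λ t → eval (P i) (ℕ→ℚ (xs t))) ≡ ℕ→ℚ N * eval (P i) (ℕ→ℚ a)
  sumImg≋multiple⇒sum-eval {k} xs N a Σf[xs]≋Nf[a] i = begin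
    sum (λ t → eval (P i) (ℕ→ℚ (xs t)))   ≡⟨ sum-cong-≗ (λ t → P≗f (xs t) i) ⟩
    sum (λ t → ℤ→ℚ (f (xs t) i))          ≡⟨ ℤ→ℚ-sumImg f k xs i ⟨
    ℤ→ℚ (sumImg f k xs i)                 ≡⟨ cong ℤ→ℚ (Σf[xs]≋Nf[a] i) ⟩
    ℤ→ℚ (sumImg f N (λ _ → a) i)          ≡⟨ ℤ→ℚ-sumImg f N (λ _ → a) i ⟩
    sum {N} (λ _ → ℤ→ℚ (f a i))           ≡⟨ sum-const N (ℤ→ℚ (f a i)) ⟩
    ℕ→ℚ N * ℤ→ℚ (f a i)                   ≡⟨ cong (ℕ→ℚ N *_) (P≗f a i) ⟨
    ℕ→ℚ N * eval (P i) (ℕ→ℚ a)            ∎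
    where open ≡-Reasoning

  point-outside-small-sumsets : ∀ i j → ¬ Proportional (P i) (P j) → ∀ m →
    Σ (ℤVec n) λ v → InSemigroup f v × ((k : ℕ) → 1 ℕ.≤ k → k ℕ.≤ m → ¬ InSumset f k v)
  point-outside-small-sumsets i j ¬Pi∼Pj m =
    let D , ψ≢0 , ψ≺φ = ¬proportional⇒cross≺dot (P i) (P j) ¬Pi∼Pj
        ψ = cross D (P i) (P j)
        φ = dot D (P i) (P j)
        a , ψa≢0 = nonzeroPoly-nonroot ψ ψ≢0
        N , 1≤N , no-representation = multiple-not-short-sum
          (λ x → eval ψ (ℕ→ℚ x)) (λ x → eval φ (ℕ→ℚ x)) a ψa≢0 (≺⇒dominated ψ φ ψ≺φ) m
    in sumImg f N (λ _ → a) , (N , 1≤N , (λ _ → a) , λ _ → refl) ,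
       λ k _ k≤m (xs , Σf[xs]≋Nf[a]) → no-representation xs k≤m
         (Σeval≡N*eval xs N a Σf[xs]≋Nf[a] (coeff (P j) D) (- coeff (P i) D))
         (Σeval≡N*eval xs N a Σf[xs]≋Nf[a] (coeff (P i) D) (coeff (P j) D))
    where
    Σeval≡N*eval : ∀ {k} (xs : Fin k → ℕ) N a → sumImg f k xs ≋ sumImg f N (λ _ → a) → ∀ u w →
      sum (λ t → eval (u ⊛ P i ⊞ w ⊛ P j) (ℕ→ℚ (xs t))) ≡ ℕ→ℚ N * eval (u ⊛ P i ⊞ w ⊛ P j) (ℕ→ℚ a)
    Σeval≡N*eval xs N a Σf[xs]≋Nf[a] u w =
      sum-eval-multiple-⊛⊞⊛ (ℕ→ℚ ∘ xs) (ℕ→ℚ a) (ℕ→ℚ N) u w (P i) (P j)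
        (sumImg≋multiple⇒sum-eval xs N a Σf[xs]≋Nf[a] i) (sumImg≋multiple⇒sum-eval xs N a Σf[xs]≋Nf[a] j)

proposition2p11 : (n : ℕ) (P : Fin n → Poly) (f : ℕ → ℤVec n) →
    (∀ x i → eval (P i) (ℕ→ℚ x) ≡ ℤ→ℚ (f x i)) →
    (Σ (Fin n) λ i → Σ (Fin n) λ j → i ≢ j × NonZeroPoly (P i) × NonZeroPoly (P j)) →
    (Σ (Fin n) λ i → Σ (Fin n) λ j → ¬ Proportional (P i) (P j)) →
    (m : ℕ) → 1 ℕ.≤ m →
    ((k : ℕ) → 1 ℕ.≤ k → k ℕ.≤ m → (v : ℤVec n) → InSumset f k v → InSemigroup f v)
    × (Σ (ℤVec n) λ v → InSemigroup f v × ((k : ℕ) → 1 ℕ.≤ k → k ℕ.≤ m → ¬ InSumset f k v))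
proposition2p11 n P f P≗f _ (i , j , ¬Pi∼Pj) m _ =
  (λ k 1≤k _ v v∈kf → k , 1≤k , v∈kf) , point-outside-small-sumsets P f P≗f i j ¬Pi∼Pj m
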